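{- Let $k\geq 2$, let $G=(V,E)$ be a graph and let $u\in V$. If there exists an induced subgraph $G_u$ of $G$ containing $u$ such that $u$ is isolated in $G_u$, $G_u-u$ is connected, and $|V(G_u-u)|\geq k$, then for every $v\in V(G_u)\setminus\{u\}$, the vertices $u$ and $v$ are clear non-neighbors.
   Context: $\mathcal{S}_k(G)$ (resp. $\overline{\mathcal{S}}_k(G)$) denotes the set of $k$-subsets of $V$ inducing a connected (resp. disconnected) subgraph of $G$. For $u,v$ with $uv\notin E$, $u$ and $v$ are clear non-neighbors if (i) there exists $S\in\mathcal{S}_k(G)$ with $v\in S$, $u\notin S$ such that for every $v'\in S\setminus\{v\}$, $(S\setminus\{v'\})\cup\{u\}\in\overline{\mathcal{S}}_k(G)$, or (ii) the same holds with the roles of $u$ and $v$ exchanged. -}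

module Defs where

open import Data.Nat using (ℕ)
open import Data.Fin using (Fin)
open import Data.Fin.Subset using (Subset; _∈_; _∉_; _∪_; _-_; ⁅_⁆; ∣_∣)
open import Data.Product using (Σ; _×_; ∃)
open import Data.Sum using (_⊎_)
open import Relation.Nullary using (¬_)
open import Relation.Binary.PropositionalEquality using (_≡_; _≢_)

record Graph (n : ℕ) : Set₁ where
  field
    Adj    : Fin n → Fin n → Set
    sym    : ∀ {x y} → Adj x y → Adj y x
    irrefl : ∀ {x} → ¬ Adj x x
open Graph public

module _ {n : ℕ} (G : Graph n) where

  data WalkIn (S : Subset n) : Fin n → Fin n → Set where
    here : ∀ {x} → x ∈ S → WalkIn S x x
    step : ∀ {x z y} → x ∈ S → Adj G x z → WalkIn S z y → WalkIn S x y

  InducesConnected : Subset n → Set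
  InducesConnected S = ∀ x y → x ∈ S → y ∈ S → WalkIn S x y

  ConnK : ℕ → Subset n → Set
  ConnK k S = ∣ S ∣ ≡ k × InducesConnected S

  DisconnK : ℕ → Subset n → Set
  DisconnK k S = ∣ S ∣ ≡ k × ¬ InducesConnected S

  ClearWitness : ℕ → Fin n → Fin n → Set
  ClearWitness k u v =
    Σ (Subset n) λ S → ConnK k S × v ∈ S × u ∉ S ×
      (∀ v' → v' ∈ S → v' ≢ v → DisconnK k ((S - v') ∪ ⁅ u ⁆))

  ClearNonNeighbors : ℕ → Fin n → Fin n → Set
  ClearNonNeighbors k u v =
    ¬ Adj G u v × (ClearWitness k u v ⊎ ClearWitness k v u)

-- Grow a connected k-set S through v inside W − u, one neighbouring vertex at a
-- time. Since u has no neighbour in W, u is isolated in (S − v') ∪ {u} for every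
-- v' ∈ S, so every such swap yields a disconnected k-set while v stays in it.
module Submission where

open import Defs
open import Data.Nat using (ℕ; _≤_; _<_; zero; suc; s≤s)
open import Data.Nat.Properties using (≤-trans; n≤1+n; <⇒≱)
open import Data.Fin using (Fin; zero; suc)
open import Data.Fin.Properties using (any?)
open import Data.Fin.Subset
  using (Subset; _∈_; _∉_; _-_; ∣_∣; _∪_; ⁅_⁆; _⊆_; inside; outside)
open import Data.Fin.Subset.Properties
open import Data.Vec using (_∷_; here; there)
open import Data.Product using (Σ-syntax; _×_; _,_)
open import Data.Sum using (inj₁; inj₂)
open import Data.Empty using (⊥-elim)
open import Function using (_∘_)
open import Relation.Nullary using (¬_; yes; no)
open import Relation.Nullary.Decidable using (_×-dec_; ¬?)
open import Relation.Binary.PropositionalEquality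
  using (_≢_; _≡_; refl; cong; trans; subst)
  renaming (sym to ≡-sym)

x∉p⇒∣p∪⁅x⁆∣≡1+∣p∣ : ∀ {n} (x : Fin n) (p : Subset n) → x ∉ p → ∣ p ∪ ⁅ x ⁆ ∣ ≡ suc ∣ p ∣
x∉p⇒∣p∪⁅x⁆∣≡1+∣p∣ zero    (outside ∷ p) _   = cong (λ q → suc ∣ q ∣) (∪-identityʳ p)
x∉p⇒∣p∪⁅x⁆∣≡1+∣p∣ zero    (inside  ∷ p) x∉p = ⊥-elim (x∉p here)
x∉p⇒∣p∪⁅x⁆∣≡1+∣p∣ (suc x) (outside ∷ p) x∉p = x∉p⇒∣p∪⁅x⁆∣≡1+∣p∣ x p (drop-not-there x∉p)
x∉p⇒∣p∪⁅x⁆∣≡1+∣p∣ (suc x) (inside  ∷ p) x∉p = cong suc (x∉p⇒∣p∪⁅x⁆∣≡1+∣p∣ x p (drop-not-there x∉p))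

x∈p⇒1+∣p-x∣≡∣p∣ : ∀ {n} (x : Fin n) (p : Subset n) → x ∈ p → suc ∣ p - x ∣ ≡ ∣ p ∣
x∈p⇒1+∣p-x∣≡∣p∣ zero    (inside  ∷ p) _   = cong (λ q → suc ∣ q ∣) (p─⊥≡p p)
x∈p⇒1+∣p-x∣≡∣p∣ (suc x) (outside ∷ p) x∈p = x∈p⇒1+∣p-x∣≡∣p∣ x p (drop-there x∈p)
x∈p⇒1+∣p-x∣≡∣p∣ (suc x) (inside  ∷ p) x∈p = cong suc (x∈p⇒1+∣p-x∣≡∣p∣ x p (drop-there x∈p))

x∉p-x : ∀ {n} (x : Fin n) (p : Subset n) → x ∉ p - x
x∉p-x (suc x) (_ ∷ p) (there x∈p-x) = x∉p-x x p x∈p-x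

∣p∣<∣q∣⇒∃x∈q∖p : ∀ {n} {p q : Subset n} → ∣ p ∣ < ∣ q ∣ → Σ[ x ∈ Fin n ] x ∈ q × x ∉ p
∣p∣<∣q∣⇒∃x∈q∖p {p = p} {q} ∣p∣<∣q∣ with any? (λ x → (x ∈? q) ×-dec ¬? (x ∈? p))
... | yes found = found
... | no none    = ⊥-elim (<⇒≱ ∣p∣<∣q∣ (p⊆q⇒∣p∣≤∣q∣ q⊆p))
  where
  q⊆p : q ⊆ p
  q⊆p {x} x∈q with x ∈? p
  ... | yes x∈p = x∈p
  ... | no  x∉p = ⊥-elim (none (x , x∈q , x∉p))

module _ {n : ℕ} (G : Graph n) where

  walk-head : ∀ {S x y} → WalkIn G S x y → x ∈ S
  walk-head (here x∈S)     = x∈S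
  walk-head (step x∈S _ _) = x∈S

  walk-mono : ∀ {S T x y} → S ⊆ T → WalkIn G S x y → WalkIn G T x y
  walk-mono S⊆T (here x∈S)       = here (S⊆T x∈S)
  walk-mono S⊆T (step x∈S xz zy) = step (S⊆T x∈S) xz (walk-mono S⊆T zy)

  walk-snoc : ∀ {S a x y} → WalkIn G S a x → Adj G x y → y ∈ S → WalkIn G S a y
  walk-snoc (here a∈S)       xy y∈S = step a∈S xy (here y∈S)
  walk-snoc (step a∈S az zx) xy y∈S = step a∈S az (walk-snoc zx xy y∈S)

  walk-leaves : ∀ {S T a y} → WalkIn G T a y → a ∈ S → y ∉ S →
    Σ[ x ∈ Fin n ] Σ[ z ∈ Fin n ] x ∈ S × z ∈ T × z ∉ S × Adj G x z
  walk-leaves (here _) a∈S y∉S = ⊥-elim (y∉S a∈S)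
  walk-leaves {S} {a = a} (step {z = z} _ az zy) a∈S y∉S with z ∈? S
  ... | yes z∈S = walk-leaves zy z∈S y∉S
  ... | no  z∉S = a , z , a∈S , walk-head zy , z∉S , az

  InducesConnected-∪⁅⁆ : ∀ {S x z} → InducesConnected G S → x ∈ S → Adj G x z →
    InducesConnected G (S ∪ ⁅ z ⁆)
  InducesConnected-∪⁅⁆ {S} {x} {z} conn x∈S xz a b a∈ b∈
    with x∈p∪q⁻ S ⁅ z ⁆ a∈ | x∈p∪q⁻ S ⁅ z ⁆ b∈
  ... | inj₁ a∈S | inj₁ b∈S = walk-mono (p⊆p∪q ⁅ z ⁆) (conn a b a∈S b∈S)
  ... | inj₁ a∈S | inj₂ b∈z rewrite x∈⁅y⁆⇒x≡y z b∈z =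
    walk-snoc (walk-mono (p⊆p∪q ⁅ z ⁆) (conn a x a∈S x∈S)) xz b∈
  ... | inj₂ a∈z | inj₁ b∈S rewrite x∈⁅y⁆⇒x≡y z a∈z =
    step a∈ (sym G xz) (walk-mono (p⊆p∪q ⁅ z ⁆) (conn x b x∈S b∈S))
  ... | inj₂ a∈z | inj₂ b∈z rewrite x∈⁅y⁆⇒x≡y z a∈z | x∈⁅y⁆⇒x≡y z b∈z = here a∈

  InducesConnected-⁅⁆ : ∀ v → InducesConnected G ⁅ v ⁆
  InducesConnected-⁅⁆ v a b a∈ b∈
    rewrite x∈⁅y⁆⇒x≡y v a∈ | x∈⁅y⁆⇒x≡y v b∈ = here (x∈⁅x⁆ v)

  record ConnectedSubsetThrough (T : Subset n) (v : Fin n) (m : ℕ) : Set where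
    field
      subset    : Subset n
      ⊆T        : subset ⊆ T
      v∈        : v ∈ subset
      size      : ∣ subset ∣ ≡ m
      connected : InducesConnected G subset

  growConnectedSubsetThrough : ∀ {T v m} → InducesConnected G T → m < ∣ T ∣ →
    ConnectedSubsetThrough T v m → ConnectedSubsetThrough T v (suc m)
  growConnectedSubsetThrough {T} {v} connT m<∣T∣
    record { subset = S ; ⊆T = S⊆T ; v∈ = v∈S ; size = ∣S∣ ; connected = connS }
    with ∣p∣<∣q∣⇒∃x∈q∖p (subst (_< ∣ T ∣) (≡-sym ∣S∣) m<∣T∣)
  ... | y , y∈T , y∉S
    with walk-leaves (connT v y (S⊆T v∈S) y∈T) v∈S y∉S
  ... | x , z , x∈S , z∈T , z∉S , xz = record
    { subset    = S ∪ ⁅ z ⁆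
    ; ⊆T        = S∪⁅z⁆⊆T
    ; v∈        = p⊆p∪q ⁅ z ⁆ v∈S
    ; size      = trans (x∉p⇒∣p∪⁅x⁆∣≡1+∣p∣ z S z∉S) (cong suc ∣S∣)
    ; connected = InducesConnected-∪⁅⁆ connS x∈S xz
    }
    where
    S∪⁅z⁆⊆T : S ∪ ⁅ z ⁆ ⊆ T
    S∪⁅z⁆⊆T w∈ with x∈p∪q⁻ S ⁅ z ⁆ w∈
    ... | inj₁ w∈S   = S⊆T w∈S
    ... | inj₂ w∈⁅z⁆ = subst (_∈ T) (≡-sym (x∈⁅y⁆⇒x≡y z w∈⁅z⁆)) z∈T

  connectedSubsetThrough : ∀ {T v} → InducesConnected G T → v ∈ T →
    ∀ m → suc m ≤ ∣ T ∣ → ConnectedSubsetThrough T v (suc m)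
  connectedSubsetThrough {T} {v} _ v∈T zero _ = record
    { subset    = ⁅ v ⁆
    ; ⊆T        = λ x∈⁅v⁆ → subst (_∈ T) (≡-sym (x∈⁅y⁆⇒x≡y v x∈⁅v⁆)) v∈T
    ; v∈        = x∈⁅x⁆ v
    ; size      = ∣⁅x⁆∣≡1 v
    ; connected = InducesConnected-⁅⁆ v
    }
  connectedSubsetThrough connT v∈T (suc m) m+2≤∣T∣ =
    growConnectedSubsetThrough connT m+2≤∣T∣
      (connectedSubsetThrough connT v∈T m (≤-trans (n≤1+n _) m+2≤∣T∣))

  isolated⇒¬InducesConnected : ∀ {P u v} → u ∈ P → v ∈ P → v ≢ u →
    (∀ z → z ∈ P → ¬ Adj G u z) → ¬ InducesConnected G P
  isolated⇒¬InducesConnected u∈P v∈P v≢u isolated connP with connP _ _ u∈P v∈P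
  ... | here _        = v≢u refl
  ... | step _ uz zv  = isolated _ (walk-head zv) uz

  noNeighbourIn⇒ClearWitness : ∀ {k S u v} → ConnK G k S → v ∈ S → u ∉ S →
    (∀ z → z ∈ S → ¬ Adj G u z) → ClearWitness G k u v
  noNeighbourIn⇒ClearWitness {k} {S} {u} {v} S∈𝒮ₖ@(∣S∣ , _) v∈S u∉S u↮S =
    S , S∈𝒮ₖ , v∈S , u∉S , swap-disconnects
    where
    swap-disconnects : ∀ v' → v' ∈ S → v' ≢ v → DisconnK G k ((S - v') ∪ ⁅ u ⁆)
    swap-disconnects v' v'∈S v'≢v =
      size , isolated⇒¬InducesConnected u∈swap v∈swap v≢u u↮swap
      where
      size : ∣ (S - v') ∪ ⁅ u ⁆ ∣ ≡ k
      size = trans (x∉p⇒∣p∪⁅x⁆∣≡1+∣p∣ u (S - v') (u∉S ∘ p─q⊆p S ⁅ v' ⁆))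
                   (trans (x∈p⇒1+∣p-x∣≡∣p∣ v' S v'∈S) ∣S∣)
      u∈swap : u ∈ (S - v') ∪ ⁅ u ⁆
      u∈swap = x∈p∪q⁺ (inj₂ (x∈⁅x⁆ u))
      v∈swap : v ∈ (S - v') ∪ ⁅ u ⁆
      v∈swap = x∈p∪q⁺ (inj₁ (x∈p∧x≢y⇒x∈p-y v∈S (v'≢v ∘ ≡-sym)))
      v≢u : v ≢ u
      v≢u refl = u∉S v∈S
      u↮swap : ∀ z → z ∈ (S - v') ∪ ⁅ u ⁆ → ¬ Adj G u z
      u↮swap z z∈ with x∈p∪q⁻ (S - v') ⁅ u ⁆ z∈
      ... | inj₁ z∈S-v' = u↮S z (p─q⊆p S ⁅ v' ⁆ z∈S-v')
      ... | inj₂ z∈⁅u⁆ rewrite x∈⁅y⁆⇒x≡y u z∈⁅u⁆ = irrefl G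

proposition4 : (k n : ℕ) → 2 ≤ k → (G : Graph n) → (u : Fin n) →
    (W : Subset n) → u ∈ W →
    (∀ w → w ∈ W → ¬ Adj G u w) →
    InducesConnected G (W - u) →
    k ≤ ∣ W - u ∣ →
    ∀ v → v ∈ W → v ≢ u → ClearNonNeighbors G k u v
proposition4 (suc k) n (s≤s _) G u W _ u↮W connW-u k+1≤∣W-u∣ v v∈W v≢u =
  u↮W v v∈W , inj₁ (noNeighbourIn⇒ClearWitness G (size , connected) v∈ u∉S u↮S)
  where
  open ConnectedSubsetThrough
    (connectedSubsetThrough G connW-u (x∈p∧x≢y⇒x∈p-y v∈W v≢u) k k+1≤∣W-u∣)
  u∉S : u ∉ subset
  u∉S u∈S = x∉p-x u W (⊆T u∈S)
  u↮S : ∀ z → z ∈ subset → ¬ Adj G u z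
  u↮S z z∈S = u↮W z (p─q⊆p W ⁅ u ⁆ (⊆T z∈S))
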